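{- Let $G$ and $H$ be graphs with $G$ connected. If the empty bisector graph $\widehat{G}$ is a complete bipartite graph, then $$\xi(G\odot H)=\beta(\widehat{G})\,\mathrm{n}(H)+\alpha(\widehat{G}).$$
   Context: All graphs are finite, simple and undirected; $\mathrm{n}(H)$ denotes the order of $H$. For a connected graph $\Gamma$, a set $S\subseteq V(\Gamma)$ is a distance-equalizer set if for every two distinct $u,v\in V(\Gamma)\setminus S$ there is $w\in S$ with $d_\Gamma(w,u)=d_\Gamma(w,v)$; $\xi(\Gamma)$ is the minimum cardinality of such a set. For $V(G)=\{v_1,\dots,v_n\}$, the corona product $G\odot H$ is obtained from $G$ and $n$ pairwise disjoint copies $H_1,\dots,H_n$ of $H$ by joining $v_i$ to every vertex of $H_i$. The empty bisector graph $\widehat{G}$ has vertex set $V(G)$, with distinct $u,v$ adjacent iff there is no $w\in V(G)$ with $d_G(w,u)=d_G(w,v)$. $\alpha$ denotes the independence number and $\beta$ the vertex cover number. -}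

module Defs where

open import Data.Nat using (ℕ; zero; suc; _+_; _*_; _≤_; _<_)
open import Data.Fin using (Fin; splitAt; remQuot)
open import Data.Fin.Properties using (_≟_)
open import Data.Fin.Subset using (Subset; _∈_; _∉_; ∣_∣)
open import Data.Bool using (Bool; true; false; T; _∧_)
open import Data.Sum using (_⊎_; inj₁; inj₂)
open import Data.Product using (Σ; _×_; _,_; proj₁; proj₂)
open import Relation.Nullary using (¬_)
open import Relation.Nullary.Decidable using (⌊_⌋)
open import Relation.Binary.PropositionalEquality using (_≡_; _≢_)

Adjacency : ℕ → Set
Adjacency n = Fin n → Fin n → Bool

record Graph (n : ℕ) : Set where
  field
    adj    : Adjacency n
    sym    : ∀ u v → adj u v ≡ adj v u
    irrefl : ∀ u → adj u u ≡ false
open Graph public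

data Walk {n : ℕ} (A : Adjacency n) : Fin n → Fin n → ℕ → Set where
  here : ∀ {u} → Walk A u u zero
  step : ∀ {u w v k} → T (A u w) → Walk A w v k → Walk A u v (suc k)

Dist : ∀ {n} → Adjacency n → Fin n → Fin n → ℕ → Set
Dist A u v k = Walk A u v k × (∀ j → j < k → ¬ Walk A u v j)

Connected : ∀ {n} → Adjacency n → Set
Connected {n} A = ∀ (u v : Fin n) → Σ ℕ λ k → Walk A u v k

EqDist : ∀ {n} → Adjacency n → Fin n → Fin n → Fin n → Set
EqDist A w u v = Σ ℕ λ k → Dist A w u k × Dist A w v k

IsDistanceEqualizer : ∀ {n} → Adjacency n → Subset n → Set
IsDistanceEqualizer {n} A S =
  ∀ (u v : Fin n) → u ≢ v → u ∉ S → v ∉ S →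
  Σ (Fin n) λ w → w ∈ S × EqDist A w u v

IsXi : ∀ {n} → Adjacency n → ℕ → Set
IsXi {n} A k =
  (Σ (Subset n) λ S → IsDistanceEqualizer A S × ∣ S ∣ ≡ k) ×
  (∀ (S : Subset n) → IsDistanceEqualizer A S → k ≤ ∣ S ∣)

BisectorAdj : ∀ {n} → Adjacency n → Fin n → Fin n → Set
BisectorAdj {n} A u v = u ≢ v × ¬ (Σ (Fin n) λ w → EqDist A w u v)

IsIndependent : ∀ {n} → (Fin n → Fin n → Set) → Subset n → Set
IsIndependent R S = ∀ u v → u ∈ S → v ∈ S → ¬ R u v

IsVertexCover : ∀ {n} → (Fin n → Fin n → Set) → Subset n → Set
IsVertexCover R S = ∀ u v → R u v → u ∈ S ⊎ v ∈ S

IsIndependenceNumber : ∀ {n} → (Fin n → Fin n → Set) → ℕ → Set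
IsIndependenceNumber {n} R k =
  (Σ (Subset n) λ S → IsIndependent R S × ∣ S ∣ ≡ k) ×
  (∀ (S : Subset n) → IsIndependent R S → ∣ S ∣ ≤ k)

IsVertexCoverNumber : ∀ {n} → (Fin n → Fin n → Set) → ℕ → Set
IsVertexCoverNumber {n} R k =
  (Σ (Subset n) λ S → IsVertexCover R S × ∣ S ∣ ≡ k) ×
  (∀ (S : Subset n) → IsVertexCover R S → k ≤ ∣ S ∣)

IsCompleteBipartite : ∀ {n} → (Fin n → Fin n → Set) → Set
IsCompleteBipartite {n} R =
  Σ (Fin n → Bool) λ side →
    (Σ (Fin n) λ a → side a ≡ true) ×
    (Σ (Fin n) λ b → side b ≡ false) ×
    (∀ u v → (R u v → side u ≢ side v) × (side u ≢ side v → R u v))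

-- Corona product G ⊙ H.  Vertex set Fin (n + n * m): the first n vertices
-- are those of G; a vertex p in the second block with remQuot m p = (i , x)
-- is vertex x of the copy H_i attached to v_i.
_==_ : ∀ {n} → Fin n → Fin n → Bool
i == j = ⌊ i ≟ j ⌋

copyOf : ∀ n m → Fin (n * m) → Fin n
copyOf n m x = proj₁ (remQuot {n} m x)

vertexOf : ∀ n m → Fin (n * m) → Fin m
vertexOf n m x = proj₂ (remQuot {n} m x)

coronaAdj : ∀ {n m} → Adjacency n → Adjacency m → Adjacency (n + n * m)
coronaAdj {n} {m} aG aH p q with splitAt n p | splitAt n q
... | inj₁ a | inj₁ b = aG a b
... | inj₁ a | inj₂ y = a == copyOf n m y
... | inj₂ x | inj₁ b = copyOf n m x == b
... | inj₂ x | inj₂ y =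
  (copyOf n m x == copyOf n m y) ∧ aH (vertexOf n m x) (vertexOf n m y)

module Submission where

-- Call column i of G ⊙ H the vertex vᵢ together with its copy Hᵢ, and let n = n(G),
-- m = n(H).  A distance in G ⊙ H between different columns i and c is d_G(i, c) plus one
-- for each endpoint that lies in a copy.
--
-- No vertex is equidistant from two leaves whose columns lie on opposite
-- sides of Ĝ, so a distance-equalizer S contains every copy Hᵢ with i in one part D of Ĝ;
-- and vᵢ and a leaf of Hᵢ are equalized only inside column i, so S meets every column.
-- Hence |S| ≥ m|D| + (n − |D|) ≥ β(Ĝ) m + α(Ĝ), as D is a vertex cover of Ĝ and α + β ≤ n.
--
-- A minimum vertex cover of Ĝ contains a part D, so |D| = β and n − |D| = α.
-- The vertices vᵢ with i ∉ D and the copies Hᵢ with i ∈ D form a distance-equalizer: two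
-- vertices outside it whose columns lie on the same side are equalized by the column of a
-- vertex of G equidistant from theirs; if the columns lie on opposite sides, some vertex of
-- G is exactly one step closer to the column outside D, which makes up for the leaf.

open import Defs
open import Data.Nat using (ℕ; zero; suc; _+_; _*_; _≤_; _<_; z≤n; s≤s; s≤s⁻¹)
open import Data.Nat.Properties
open import Data.Nat.Tactic.RingSolver using (solve-∀)
open import Algebra.Properties.Semiring.Sum +-*-semiring
  using (sum; sum-syntax; sum-cong-≗; ∑-distrib-+; *-distribˡ-sum)
open import Data.Bool using (Bool; true; false; T; not; if_then_else_)
import Data.Bool.Properties as Bool
open import Data.Bool.Properties using (not-injective; not-¬; T-∧)
open import Data.Empty using (⊥-elim)
open import Data.Fin using (Fin; zero; suc; _↑ˡ_; _↑ʳ_; combine; splitAt; fromℕ<)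
import Data.Fin.Properties as Fin
open import Data.Fin.Properties
  using (any?; all?; ¬∀⟶∃¬; splitAt-↑ˡ; splitAt-↑ʳ; splitAt⁻¹-↑ˡ; splitAt⁻¹-↑ʳ;
         remQuot-combine; combine-remQuot; ↑ʳ-injective; combine-injectiveˡ)
open import Data.Fin.Subset using (Subset; _∈_; _∉_; ∣_∣; ∁)
open import Data.Fin.Subset.Properties
  using (_∈?_; ∣p∣≤n; ∣∁p∣≡n∸∣p∣; p⊆q⇒∣p∣≤∣q∣; x∉p⇒x∈∁p)
open import Data.Product using (Σ; Σ-syntax; ∃-syntax; _×_; _,_; proj₁; proj₂; map₂; swap)
open import Data.Sum using (_⊎_; inj₁; inj₂; [_,_]′)
open import Data.Vec using ([]; _∷_; lookup; tabulate)
open import Data.Vec.Properties using (lookup∘tabulate; tabulate-∘; []=⇒lookup; lookup⇒[]=)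
open import Function using (_∘_; id)
open import Function.Bundles using (Equivalence)
open import Relation.Binary.PropositionalEquality
  using (_≗_; _≡_; _≢_; refl; trans; cong; cong₂; subst; module ≡-Reasoning)
import Relation.Binary.PropositionalEquality as ≡
open import Relation.Nullary using (¬_; Dec; yes; no; ¬?)
open import Relation.Nullary.Decidable
  using (_×-dec_; decidable-stable; T?; fromWitness; toWitness)
open import Relation.Nullary.Negation using (contradiction)
open import Relation.Unary using (Decidable)

𝟙 : Bool → ℕ
𝟙 b = if b then 1 else 0

1≤𝟙 : ∀ {b} → b ≡ true → 1 ≤ 𝟙 b
1≤𝟙 refl = ≤-refl

sum-mono-≤ : ∀ {k} {f g : Fin k → ℕ} → (∀ i → f i ≤ g i) → sum f ≤ sum g
sum-mono-≤ {zero}  f≤g = z≤n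
sum-mono-≤ {suc k} f≤g = +-mono-≤ (f≤g zero) (sum-mono-≤ (f≤g ∘ suc))

term≤sum : ∀ {k} (f : Fin k → ℕ) i → f i ≤ sum f
term≤sum f zero    = m≤m+n _ _
term≤sum f (suc i) = ≤-trans (term≤sum (f ∘ suc) i) (m≤n+m _ _)

sum-const : ∀ k c → ∑[ i < k ] c ≡ k * c
sum-const zero    c = refl
sum-const (suc k) c = cong (c +_) (sum-const k c)

sum-↑ : ∀ a b (f : Fin (a + b) → ℕ) →
        sum f ≡ ∑[ i < a ] f (i ↑ˡ b) + ∑[ j < b ] f (a ↑ʳ j)
sum-↑ zero    b f = refl
sum-↑ (suc a) b f =
  trans (cong (f zero +_) (sum-↑ a b (f ∘ suc))) (≡.sym (+-assoc (f zero) _ _))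

sum-combine : ∀ a b (f : Fin (a * b) → ℕ) → sum f ≡ ∑[ i < a ] ∑[ j < b ] f (combine i j)
sum-combine zero    b f = refl
sum-combine (suc a) b f = trans (sum-↑ b (a * b) f)
  (cong (∑[ j < b ] f (j ↑ˡ (a * b)) +_) (sum-combine a b (f ∘ (b ↑ʳ_))))

∣p∣≡∑𝟙 : ∀ {k} (p : Subset k) → ∣ p ∣ ≡ ∑[ i < k ] 𝟙 (lookup p i)
∣p∣≡∑𝟙 []          = refl
∣p∣≡∑𝟙 (true ∷ p)  = cong suc (∣p∣≡∑𝟙 p)
∣p∣≡∑𝟙 (false ∷ p) = ∣p∣≡∑𝟙 p

∣tabulate∣≡∑𝟙 : ∀ {k} (f : Fin k → Bool) → ∣ tabulate f ∣ ≡ ∑[ i < k ] 𝟙 (f i)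
∣tabulate∣≡∑𝟙 f = trans (∣p∣≡∑𝟙 (tabulate f)) (sum-cong-≗ (cong 𝟙 ∘ lookup∘tabulate f))

∣p∣+∣∁p∣≡n : ∀ {k} (p : Subset k) → ∣ p ∣ + ∣ ∁ p ∣ ≡ k
∣p∣+∣∁p∣≡n p = trans (cong (∣ p ∣ +_) (∣∁p∣≡n∸∣p∣ p)) (m+[n∸m]≡n (∣p∣≤n p))

∣tabulate∣+∣tabulate-not∣≡n : ∀ {k} (f : Fin k → Bool) →
                              ∣ tabulate f ∣ + ∣ tabulate (not ∘ f) ∣ ≡ k
∣tabulate∣+∣tabulate-not∣≡n f =
  trans (cong (λ p → ∣ tabulate f ∣ + ∣ p ∣) (tabulate-∘ not f)) (∣p∣+∣∁p∣≡n (tabulate f))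

∈-tabulate⁺ : ∀ {k} {f : Fin k → Bool} {i} → f i ≡ true → i ∈ tabulate f
∈-tabulate⁺ {f = f} {i} fi = lookup⇒[]= i (tabulate f) (trans (lookup∘tabulate f i) fi)

∈-tabulate⁻ : ∀ {k} {f : Fin k → Bool} {i} → i ∈ tabulate f → f i ≡ true
∈-tabulate⁻ {f = f} {i} i∈ = trans (≡.sym (lookup∘tabulate f i)) ([]=⇒lookup i∈)

b*m+a≤m*k+l : ∀ {m a b k l} → 1 ≤ m → b ≤ k → a + b ≤ k + l → b * m + a ≤ m * k + l
b*m+a≤m*k+l {suc m} {a} {b} {k} {l} _ b≤k a+b≤k+l = begin
  b * suc m + a    ≡⟨ lhs m a b ⟩
  m * b + (a + b)  ≤⟨ +-mono-≤ (*-monoʳ-≤ m b≤k) a+b≤k+l ⟩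
  m * k + (k + l)  ≡⟨ rhs m k l ⟩
  suc m * k + l    ∎
  where
  open ≤-Reasoning
  lhs : ∀ m a b → b * suc m + a ≡ m * b + (a + b)
  lhs = solve-∀
  rhs : ∀ m k l → m * k + (k + l) ≡ suc m * k + l
  rhs = solve-∀

least : ∀ {p} {P : ℕ → Set p} → Decidable P → ∀ {k} → P k →
        Σ[ j ∈ ℕ ] P j × (∀ i → i < j → ¬ P i)
least P? {k} Pk with P? 0
... | yes P0 = 0 , P0 , λ _ ()
least P? {zero}  Pk | no ¬P0 = ⊥-elim (¬P0 Pk)
least P? {suc k} Pk | no ¬P0 with least (P? ∘ suc) Pk
... | j , Pj , below = suc j , Pj , λ { zero _ → ¬P0 ; (suc i) i<j → below i (s≤s⁻¹ i<j) }

module _ {k} {A : Adjacency k} where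

  walk? : ∀ j u v → Dec (Walk A u v j)
  walk? zero u v with u Fin.≟ v
  ... | yes refl = yes here
  ... | no u≢v   = no λ { here → u≢v refl }
  walk? (suc j) u v with any? (λ w → T? (A u w) ×-dec walk? j w v)
  ... | yes (w , e , p) = yes (step e p)
  ... | no ¬p           = no λ { (step e p) → ¬p (_ , e , p) }

  _∷ʳ_ : ∀ {u v w j} → Walk A u v j → T (A v w) → Walk A u w (suc j)
  here     ∷ʳ e  = step e here
  step e p ∷ʳ e′ = step e (p ∷ʳ e′)

  dist-minimal : ∀ {u v i j} → Dist A u v j → Walk A u v i → j ≤ i
  dist-minimal {i = i} {j} (_ , below) p with j ≤? i
  ... | yes j≤i = j≤i
  ... | no j≰i  = ⊥-elim (below i (≰⇒> j≰i) p)

  dist-unique : ∀ {u v i j} → Dist A u v i → Dist A u v j → i ≡ j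
  dist-unique Dᵢ Dⱼ = ≤-antisym (dist-minimal Dᵢ (proj₁ Dⱼ)) (dist-minimal Dⱼ (proj₁ Dᵢ))

  walk⇒dist : ∀ {u v j} → Walk A u v j → Σ ℕ (Dist A u v)
  walk⇒dist {u} {v} = least (λ i → walk? i u v)

  equidistant : ∀ {w u v j} → Dist A w u j → Dist A w v j → EqDist A w u v
  equidistant {j = j} Dᵤ Dᵥ = j , Dᵤ , Dᵥ

  equidistant⁻ : ∀ {w u v i j} → EqDist A w u v → Dist A w u i → Dist A w v j → i ≡ j
  equidistant⁻ (_ , Dᵤ , Dᵥ) Dᵢ Dⱼ = trans (dist-unique Dᵢ Dᵤ) (dist-unique Dᵥ Dⱼ)

  module _ (φ : Fin k → ℕ) (lipschitz : ∀ {u w} → T (A u w) → φ u ≤ suc (φ w)) where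

    potential≤length : ∀ {u v j} → Walk A u v j → φ u ≤ j + φ v
    potential≤length here       = ≤-refl
    potential≤length (step e p) = ≤-trans (lipschitz e) (s≤s (potential≤length p))

    potential⇒dist : ∀ {u v j} → φ v ≡ 0 → φ u ≡ j → Walk A u v j → Dist A u v j
    potential⇒dist {u} {v} {j} φv≡0 φu≡j p = p , λ i i<j q → <⇒≱ i<j (begin
      j        ≡⟨ φu≡j ⟨
      φ u      ≤⟨ potential≤length q ⟩
      i + φ v  ≡⟨ cong (i +_) φv≡0 ⟩
      i + 0    ≡⟨ +-identityʳ i ⟩
      i        ∎)
      where open ≤-Reasoning

CompleteBipartiteBy : ∀ {k} → (Fin k → Fin k → Set) → (Fin k → Bool) → Set
CompleteBipartiteBy R σ = ∀ u v → (R u v → σ u ≢ σ v) × (σ u ≢ σ v → R u v)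

module Distance {k} (A : Adjacency k) (connected : Connected A) where

  opaque
    shortest : ∀ u v → Σ ℕ (Dist A u v)
    shortest u v = walk⇒dist (proj₂ (connected u v))

  d : Fin k → Fin k → ℕ
  d u v = proj₁ (shortest u v)

  d-dist : ∀ u v → Dist A u v (d u v)
  d-dist u v = proj₂ (shortest u v)

  shortest-walk : ∀ u v → Walk A u v (d u v)
  shortest-walk u v = proj₁ (d-dist u v)

  dist⇒d≡ : ∀ {u v j} → Dist A u v j → d u v ≡ j
  dist⇒d≡ = dist-unique (d-dist _ _)

  d-refl : ∀ u → d u u ≡ 0
  d-refl u = dist⇒d≡ (here , λ _ ())

  d-lipschitz : ∀ {u w} c → T (A u w) → d u c ≤ suc (d w c)
  d-lipschitz c e = dist-minimal (d-dist _ c) (step e (shortest-walk _ c))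

  eqDist⇒≡ : ∀ {w u v} → EqDist A w u v → d w u ≡ d w v
  eqDist⇒≡ (_ , Dᵤ , Dᵥ) = trans (dist⇒d≡ Dᵤ) (≡.sym (dist⇒d≡ Dᵥ))

  ≡⇒eqDist : ∀ {w u v} → d w u ≡ d w v → EqDist A w u v
  ≡⇒eqDist {w} {u} {v} e =
    equidistant (d-dist w u) (subst (Dist A w v) (≡.sym e) (d-dist w v))

  bisector⇒unbisected : ∀ {u v} → BisectorAdj A u v → ∀ w → d w u ≢ d w v
  bisector⇒unbisected (_ , ¬equidistant) w e = ¬equidistant (w , ≡⇒eqDist e)

  module _ {σ : Fin k → Bool} (bip : CompleteBipartiteBy (BisectorAdj A) σ) where

    same-side⇒equidistant : ∀ {u v} → σ u ≡ σ v → ∃[ w ] d w u ≡ d w v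
    same-side⇒equidistant {u} {v} σu≡σv with u Fin.≟ v
    ... | yes refl = u , refl
    ... | no u≢v   = decidable-stable (any? λ w → d w u ≟ d w v) λ none →
      proj₁ (bip u v) (u≢v , λ (w , E) → none (w , eqDist⇒≡ E)) σu≡σv

    other-side⇒unbisected : ∀ {u v} → σ u ≢ σ v → ∀ w → d w u ≢ d w v
    other-side⇒unbisected {u} {v} σu≢σv = bisector⇒unbisected (proj₂ (bip u v) σu≢σv)

  -- Along a walk from u to v, d x v − d x u starts positive, never vanishes and drops by at
  -- most 2 per step, so it cannot jump from ≥ 2 to a negative value: it passes through 1.
  closer-by-one : (∀ u w → A u w ≡ A w u) → ∀ {u v} → (∀ w → d w u ≢ d w v) →
                  ∃[ l ] d l v ≡ suc (d l u)
  closer-by-one symmetric {u} {v} unbisected = go (shortest-walk u v) du<dv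
    where
    du<dv : d u u < d u v
    du<dv rewrite d-refl u = n≢0⇒n>0 (λ e → unbisected u (trans (d-refl u) (≡.sym e)))

    go : ∀ {x j} → Walk A x v j → d x u < d x v → ∃[ l ] d l v ≡ suc (d l u)
    go here lt = ⊥-elim (n≮0 (subst (d v u <_) (d-refl v) lt))
    go {x} (step {w = w} e p) lt with d x v ≟ suc (d x u)
    ... | yes closer = x , closer
    ... | no ¬closer = go p (≤∧≢⇒< dwu≤dwv (unbisected w))
      where
      open ≤-Reasoning
      dwu≤dwv : d w u ≤ d w v
      dwu≤dwv = begin
        d w u        ≤⟨ d-lipschitz u (subst T (symmetric x w) e) ⟩
        suc (d x u)  ≤⟨ s≤s⁻¹ (≤-trans (≤∧≢⇒< lt (¬closer ∘ ≡.sym)) (d-lipschitz v e)) ⟩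
        d w v        ∎

module _ {k} {R : Fin k → Fin k → Set} where

  independent⇒∁-cover : ∀ {I} → IsIndependent R I → IsVertexCover R (∁ I)
  independent⇒∁-cover {I} independent u v r with u ∈? I | v ∈? I
  ... | yes u∈I | yes v∈I = ⊥-elim (independent u v u∈I v∈I r)
  ... | no  u∉I | _       = inj₁ (x∉p⇒x∈∁p u∉I)
  ... | yes _   | no v∉I  = inj₂ (x∉p⇒x∈∁p v∉I)

  α+β≤n : ∀ {a b} → IsIndependenceNumber R a → IsVertexCoverNumber R b → a + b ≤ k
  α+β≤n {a} {b} ((I , independent , ∣I∣≡a) , _) (_ , β-minimal) = begin
    a + b            ≤⟨ +-mono-≤ (≤-reflexive (≡.sym ∣I∣≡a))
                                 (β-minimal (∁ I) (independent⇒∁-cover independent)) ⟩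
    ∣ I ∣ + ∣ ∁ I ∣  ≡⟨ ∣p∣+∣∁p∣≡n I ⟩
    k                ∎
    where open ≤-Reasoning

module _ {k} {R : Fin k → Fin k → Set} {σ : Fin k → Bool} (bip : CompleteBipartiteBy R σ) where

  not-sides : CompleteBipartiteBy R (not ∘ σ)
  not-sides u v = (λ r → proj₁ (bip u v) r ∘ not-injective)
                , (λ σu≢σv → proj₂ (bip u v) (σu≢σv ∘ cong not))

  side-cover : IsVertexCover R (tabulate σ)
  side-cover u v r with σ u in σu | σ v in σv
  ... | true  | _     = inj₁ (∈-tabulate⁺ σu)
  ... | false | true  = inj₂ (∈-tabulate⁺ σv)
  ... | false | false = ⊥-elim (proj₁ (bip u v) r (trans σu (≡.sym σv)))

  coside-independent : IsIndependent R (tabulate (not ∘ σ))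
  coside-independent u v u∈ v∈ r =
    proj₁ (bip u v) r (not-injective (trans (∈-tabulate⁻ u∈) (≡.sym (∈-tabulate⁻ v∈))))

  cover⊇side : ∀ {p} {P : Fin k → Set p} → Decidable P → (∀ u v → R u v → P u ⊎ P v) →
               Σ[ σ′ ∈ (Fin k → Bool) ] CompleteBipartiteBy R σ′ × (∀ u → σ′ u ≡ true → P u)
  cover⊇side P? cover with any? (λ u → (σ u Bool.≟ true) ×-dec ¬? (P? u))
  ... | no none = σ , bip , λ u σu → decidable-stable (P? u) (λ ¬Pu → none (u , σu , ¬Pu))
  ... | yes (u₀ , σu₀ , ¬Pu₀) = not ∘ σ , not-sides , λ u σu →
    [ ⊥-elim ∘ ¬Pu₀ , id ]′
      (cover u₀ u (proj₂ (bip u₀ u) λ e → not-¬ (trans (≡.sym e) σu₀) (not-injective σu)))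

optimal-side : ∀ {k} {R : Fin k → Fin k → Set} {σ a b} → CompleteBipartiteBy R σ →
               IsIndependenceNumber R a → IsVertexCoverNumber R b →
               Σ[ σ′ ∈ (Fin k → Bool) ] CompleteBipartiteBy R σ′ ×
                 ∣ tabulate σ′ ∣ ≡ b × ∣ tabulate (not ∘ σ′) ∣ ≡ a
optimal-side {k} {a = a} {b} bip α β@((C , cover , ∣C∣≡b) , β-minimal)
  with cover⊇side bip (_∈? C) cover
... | σ′ , bip′ , side⊆C = σ′ , bip′ , ∣side∣≡b , ∣coside∣≡a
  where
  ∣side∣≡b : ∣ tabulate σ′ ∣ ≡ b
  ∣side∣≡b = ≤-antisym (subst (_ ≤_) ∣C∣≡b (p⊆q⇒∣p∣≤∣q∣ (side⊆C _ ∘ ∈-tabulate⁻)))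
                       (β-minimal _ (side-cover bip′))

  ∣coside∣≡a : ∣ tabulate (not ∘ σ′) ∣ ≡ a
  ∣coside∣≡a = ≤-antisym (proj₂ α _ (coside-independent bip′)) (+-cancelʳ-≤ b a _ (begin
    a + b                                      ≤⟨ α+β≤n α β ⟩
    k                                          ≡⟨ ∣tabulate∣+∣tabulate-not∣≡n σ′ ⟨
    ∣ tabulate σ′ ∣ + ∣ tabulate (not ∘ σ′) ∣  ≡⟨ cong (_+ _) ∣side∣≡b ⟩
    b + ∣ tabulate (not ∘ σ′) ∣                ≡⟨ +-comm b _ ⟩
    ∣ tabulate (not ∘ σ′) ∣ + b                ∎))
    where open ≤-Reasoning

==⇒≡ : ∀ {k} {i j : Fin k} → T (i == j) → i ≡ j
==⇒≡ {i = i} {j} = toWitness {a? = i Fin.≟ j}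

module Corona {n m} (G : Graph n) (H : Graph m) where

  C : Adjacency (n + n * m)
  C = coronaAdj (adj G) (adj H)

  base : Fin n → Fin (n + n * m)
  base i = i ↑ˡ (n * m)

  leaf : Fin n → Fin m → Fin (n + n * m)
  leaf i x = n ↑ʳ combine i x

  splitAt-base : ∀ i → splitAt n (base i) ≡ inj₁ i
  splitAt-base i = splitAt-↑ˡ n i (n * m)

  splitAt-leaf : ∀ i x → splitAt n (leaf i x) ≡ inj₂ (combine i x)
  splitAt-leaf i x = splitAt-↑ʳ n (n * m) (combine i x)

  copyOf-combine : ∀ i x → copyOf n m (combine i x) ≡ i
  copyOf-combine i x = cong proj₁ (remQuot-combine i x)

  data View : Fin (n + n * m) → Set where
    base-view : ∀ i → View (base i)
    leaf-view : ∀ i x → View (leaf i x)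

  view : ∀ p → View p
  view p with splitAt n p in eq
  ... | inj₁ i = subst View (splitAt⁻¹-↑ˡ eq) (base-view i)
  ... | inj₂ y = subst View (trans (cong (n ↑ʳ_) (combine-remQuot {n} m y)) (splitAt⁻¹-↑ʳ eq))
                           (leaf-view (copyOf n m y) (vertexOf n m y))

  base≢leaf : ∀ {i j x} → base i ≢ leaf j x
  base≢leaf {i} {j} {x} e
    with trans (≡.sym (splitAt-base i)) (trans (cong (splitAt n) e) (splitAt-leaf j x))
  ... | ()

  leaf-injectiveˡ : ∀ {i j x y} → leaf i x ≡ leaf j y → i ≡ j
  leaf-injectiveˡ {i} {j} {x} {y} e = combine-injectiveˡ i x j y (↑ʳ-injective n _ _ e)

  base-edge : ∀ {i j} → T (adj G i j) → T (C (base i) (base j))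
  base-edge {i} {j} e rewrite splitAt-base i | splitAt-base j = e

  spoke : ∀ i x → T (C (base i) (leaf i x))
  spoke i x rewrite splitAt-base i | splitAt-leaf i x | copyOf-combine i x = fromWitness refl

  spoke⁻¹ : ∀ i x → T (C (leaf i x) (base i))
  spoke⁻¹ i x rewrite splitAt-base i | splitAt-leaf i x | copyOf-combine i x = fromWitness refl

  lift : ∀ {i j k} → Walk (adj G) i j k → Walk C (base i) (base j) k
  lift here       = here
  lift (step e p) = step (base-edge e) (lift p)

  columnSize : Subset (n + n * m) → Fin n → ℕ
  columnSize S i = 𝟙 (lookup S (base i)) + ∑[ x < m ] 𝟙 (lookup S (leaf i x))

  ∣S∣≡∑columnSize : ∀ S → ∣ S ∣ ≡ ∑[ i < n ] columnSize S i
  ∣S∣≡∑columnSize S = begin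
    ∣ S ∣                                              ≡⟨ ∣p∣≡∑𝟙 S ⟩
    ∑[ p < n + n * m ] χ p                             ≡⟨ sum-↑ n (n * m) χ ⟩
    ∑[ i < n ] χ (base i) + ∑[ y < n * m ] χ (n ↑ʳ y)
      ≡⟨ cong (sum (χ ∘ base) +_) (sum-combine n m (χ ∘ (n ↑ʳ_))) ⟩
    ∑[ i < n ] χ (base i) + ∑[ i < n ] ∑[ x < m ] χ (leaf i x)
      ≡⟨ ∑-distrib-+ (χ ∘ base) (λ i → ∑[ x < m ] χ (leaf i x)) ⟨
    ∑[ i < n ] columnSize S i                          ∎
    where
    open ≡-Reasoning
    χ : Fin (n + n * m) → ℕ
    χ = 𝟙 ∘ lookup S

  weight : (Fin n → Bool) → Fin n → ℕ
  weight h i = if h i then m else 1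

  ∑weight : ∀ h → ∑[ i < n ] weight h i ≡ m * ∣ tabulate h ∣ + ∣ tabulate (not ∘ h) ∣
  ∑weight h = begin
    ∑[ i < n ] weight h i                                ≡⟨ sum-cong-≗ (weight-𝟙 ∘ h) ⟩
    ∑[ i < n ] (m * 𝟙 (h i) + 𝟙 (not (h i)))
      ≡⟨ ∑-distrib-+ (λ i → m * 𝟙 (h i)) (𝟙 ∘ not ∘ h) ⟩
    ∑[ i < n ] (m * 𝟙 (h i)) + ∑[ i < n ] 𝟙 (not (h i))  ≡⟨ cong (_+ _) (*-distribˡ-sum m (𝟙 ∘ h)) ⟨
    m * (∑[ i < n ] 𝟙 (h i)) + ∑[ i < n ] 𝟙 (not (h i))
      ≡⟨ cong₂ (λ s t → m * s + t) (∣tabulate∣≡∑𝟙 h) (∣tabulate∣≡∑𝟙 (not ∘ h)) ⟨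
    m * ∣ tabulate h ∣ + ∣ tabulate (not ∘ h) ∣          ∎
    where
    open ≡-Reasoning
    weight-𝟙 : ∀ b → (if b then m else 1) ≡ m * 𝟙 b + 𝟙 (not b)
    weight-𝟙 true  = ≡.sym (trans (+-identityʳ _) (*-identityʳ m))
    weight-𝟙 false = ≡.sym (cong (_+ 1) (*-zeroʳ m))

  weight≤columnSize : ∀ {S} h {i} → base i ∈ S ⊎ ∃[ x ] leaf i x ∈ S →
                      (h i ≡ true → ∀ x → leaf i x ∈ S) → weight h i ≤ columnSize S i
  weight≤columnSize {S} h {i} meets heavy with h i
  ... | true = begin
    m                                   ≡⟨ trans (sum-const m 1) (*-identityʳ m) ⟨
    ∑[ x < m ] 1                        ≡⟨ sum-cong-≗ (λ x → cong 𝟙 ([]=⇒lookup (heavy refl x))) ⟨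
    ∑[ x < m ] 𝟙 (lookup S (leaf i x))  ≤⟨ m≤n+m _ (𝟙 (lookup S (base i))) ⟩
    columnSize S i                      ∎
    where open ≤-Reasoning
  ... | false with meets
  ...   | inj₁ base∈S       = ≤-trans (1≤𝟙 ([]=⇒lookup base∈S)) (m≤m+n _ _)
  ...   | inj₂ (x , leaf∈S) = ≤-trans (1≤𝟙 ([]=⇒lookup leaf∈S))
    (≤-trans (term≤sum (λ x → 𝟙 (lookup S (leaf i x))) x) (m≤n+m _ (𝟙 (lookup S (base i)))))

  -- The paper's (V(G) ∖ D) ∪ ⋃_{i ∈ D} V(Hᵢ) for the set D of heavy columns, h i ≡ true.
  coronaSet : (Fin n → Bool) → Subset (n + n * m)
  coronaSet h = tabulate ([ not ∘ h , h ∘ copyOf n m ]′ ∘ splitAt n)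

  module _ (h : Fin n → Bool) where

    lookup-coronaSet-base : ∀ i → lookup (coronaSet h) (base i) ≡ not (h i)
    lookup-coronaSet-base i =
      trans (lookup∘tabulate _ (base i)) (cong [ not ∘ h , h ∘ copyOf n m ]′ (splitAt-base i))

    lookup-coronaSet-leaf : ∀ i x → lookup (coronaSet h) (leaf i x) ≡ h i
    lookup-coronaSet-leaf i x = trans (lookup∘tabulate _ (leaf i x))
      (trans (cong [ not ∘ h , h ∘ copyOf n m ]′ (splitAt-leaf i x)) (cong h (copyOf-combine i x)))

    base∈coronaSet : ∀ {i} → h i ≡ false → base i ∈ coronaSet h
    base∈coronaSet {i} hi = lookup⇒[]= _ _ (trans (lookup-coronaSet-base i) (cong not hi))

    leaf∈coronaSet : ∀ {i} x → h i ≡ true → leaf i x ∈ coronaSet h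
    leaf∈coronaSet {i} x hi = lookup⇒[]= _ _ (trans (lookup-coronaSet-leaf i x) hi)

    base∉⇒heavy : ∀ {i} → base i ∉ coronaSet h → h i ≡ true
    base∉⇒heavy {i} base∉ with h i in hi
    ... | true  = refl
    ... | false = ⊥-elim (base∉ (base∈coronaSet hi))

    leaf∉⇒light : ∀ {i x} → leaf i x ∉ coronaSet h → h i ≡ false
    leaf∉⇒light {i} {x} leaf∉ with h i in hi
    ... | true  = ⊥-elim (leaf∉ (leaf∈coronaSet x hi))
    ... | false = refl

    columnSize-coronaSet : columnSize (coronaSet h) ≗ weight h
    columnSize-coronaSet i
      rewrite lookup-coronaSet-base i | sum-cong-≗ (cong 𝟙 ∘ lookup-coronaSet-leaf i) with h i
    ... | true  = trans (sum-const m 1) (*-identityʳ m)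
    ... | false = cong suc (trans (sum-const m 0) (*-zeroʳ m))

    ∣coronaSet∣≡∑weight : ∣ coronaSet h ∣ ≡ ∑[ i < n ] weight h i
    ∣coronaSet∣≡∑weight =
      trans (∣S∣≡∑columnSize (coronaSet h)) (sum-cong-≗ columnSize-coronaSet)

    ∣coronaSet∣ : ∣ coronaSet h ∣ ≡ m * ∣ tabulate h ∣ + ∣ tabulate (not ∘ h) ∣
    ∣coronaSet∣ = trans ∣coronaSet∣≡∑weight (∑weight h)

    ∣coronaSet∣≤∣S∣ : ∀ {S} → (∀ i → base i ∈ S ⊎ ∃[ x ] leaf i x ∈ S) →
                      (∀ i → h i ≡ true → ∀ x → leaf i x ∈ S) → ∣ coronaSet h ∣ ≤ ∣ S ∣
    ∣coronaSet∣≤∣S∣ {S} meets heavy = begin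
      ∣ coronaSet h ∣            ≡⟨ ∣coronaSet∣≡∑weight ⟩
      ∑[ i < n ] weight h i      ≤⟨ sum-mono-≤ (λ i → weight≤columnSize h (meets i) (heavy i)) ⟩
      ∑[ i < n ] columnSize S i  ≡⟨ ∣S∣≡∑columnSize S ⟨
      ∣ S ∣                      ∎
      where open ≤-Reasoning

  b*m+a≤∣coronaSet∣ : ∀ {R : Fin n → Fin n → Set} {h a b} → 1 ≤ m → CompleteBipartiteBy R h →
                      IsIndependenceNumber R a → IsVertexCoverNumber R b →
                      b * m + a ≤ ∣ coronaSet h ∣
  b*m+a≤∣coronaSet∣ {h = h} {a} {b} 1≤m bip α β = begin
    b * m + a                                    ≤⟨ b*m+a≤m*k+l 1≤m b≤side a+b≤n ⟩
    m * ∣ tabulate h ∣ + ∣ tabulate (not ∘ h) ∣  ≡⟨ ∣coronaSet∣ h ⟨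
    ∣ coronaSet h ∣                              ∎
    where
    open ≤-Reasoning
    b≤side : b ≤ ∣ tabulate h ∣
    b≤side = proj₂ β _ (side-cover bip)
    a+b≤n : a + b ≤ ∣ tabulate h ∣ + ∣ tabulate (not ∘ h) ∣
    a+b≤n = ≤-trans (α+β≤n α β) (≤-reflexive (≡.sym (∣tabulate∣+∣tabulate-not∣≡n h)))

  module Metric (connected : Connected (adj G)) where

    open Distance (adj G) connected

    -- Lower bounds for the distance to base c and to the leaves of column c, read off the
    -- split vertex: they are 1-Lipschitz along edges and vanish at the target, so any walk
    -- realising them is shortest (potential⇒dist).  toLeaves c is 0 on the whole copy H_c.
    toBase : Fin n → Fin n ⊎ Fin (n * m) → ℕ
    toBase c (inj₁ i) = d i c
    toBase c (inj₂ y) = suc (d (copyOf n m y) c)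

    leafToLeaves : Fin n → Fin n → ℕ
    leafToLeaves c i with i Fin.≟ c
    ... | yes _ = 0
    ... | no  _ = suc (suc (d i c))

    toLeaves : Fin n → Fin n ⊎ Fin (n * m) → ℕ
    toLeaves c (inj₁ i) = suc (d i c)
    toLeaves c (inj₂ y) = leafToLeaves c (copyOf n m y)

    toBase-lipschitz : ∀ c {p q} → T (C p q) → toBase c (splitAt n p) ≤ suc (toBase c (splitAt n q))
    toBase-lipschitz c {p} {q} e with splitAt n p | splitAt n q
    ... | inj₁ i | inj₁ j = d-lipschitz c e
    ... | inj₁ i | inj₂ y rewrite ==⇒≡ e = m≤n⇒m≤1+n (n≤1+n _)
    ... | inj₂ x | inj₁ j rewrite ==⇒≡ e = ≤-refl
    ... | inj₂ x | inj₂ y = subst (λ j → suc (d (copyOf n m x) c) ≤ suc (suc (d j c)))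
                              (==⇒≡ (proj₁ (Equivalence.to T-∧ e))) (n≤1+n _)

    toLeaves-lipschitz : ∀ c {p q} → T (C p q) →
                         toLeaves c (splitAt n p) ≤ suc (toLeaves c (splitAt n q))
    toLeaves-lipschitz c {p} {q} e with splitAt n p | splitAt n q
    ... | inj₁ i | inj₁ j = s≤s (d-lipschitz c e)
    ... | inj₁ i | inj₂ y rewrite ==⇒≡ e = base≤leaf (copyOf n m y)
      where
      base≤leaf : ∀ j → suc (d j c) ≤ suc (leafToLeaves c j)
      base≤leaf j with j Fin.≟ c
      ... | yes refl = s≤s (≤-reflexive (d-refl j))
      ... | no  _    = s≤s (m≤n⇒m≤1+n (n≤1+n _))
    ... | inj₂ x | inj₁ j rewrite ==⇒≡ e = leaf≤base j
      where
      leaf≤base : ∀ j → leafToLeaves c j ≤ suc (suc (d j c))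
      leaf≤base j with j Fin.≟ c
      ... | yes _ = z≤n
      ... | no  _ = ≤-refl
    ... | inj₂ x | inj₂ y = subst (λ j → leafToLeaves c (copyOf n m x) ≤ suc (leafToLeaves c j))
                              (==⇒≡ (proj₁ (Equivalence.to T-∧ e))) (n≤1+n _)

    toBase-base : ∀ c i → toBase c (splitAt n (base i)) ≡ d i c
    toBase-base c i = cong (toBase c) (splitAt-base i)

    toBase-leaf : ∀ c i x → toBase c (splitAt n (leaf i x)) ≡ suc (d i c)
    toBase-leaf c i x =
      trans (cong (toBase c) (splitAt-leaf i x)) (cong (λ j → suc (d j c)) (copyOf-combine i x))

    toLeaves-leaf : ∀ c i x → toLeaves c (splitAt n (leaf i x)) ≡ leafToLeaves c i
    toLeaves-leaf c i x =
      trans (cong (toLeaves c) (splitAt-leaf i x)) (cong (leafToLeaves c) (copyOf-combine i x))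

    leafToLeaves-self : ∀ c → leafToLeaves c c ≡ 0
    leafToLeaves-self c with c Fin.≟ c
    ... | yes _   = refl
    ... | no  c≢c = contradiction refl c≢c

    leafToLeaves-other : ∀ {i c} → i ≢ c → leafToLeaves c i ≡ suc (suc (d i c))
    leafToLeaves-other {i} {c} i≢c with i Fin.≟ c
    ... | yes i≡c = contradiction i≡c i≢c
    ... | no  _   = refl

    toBase-target : ∀ c → toBase c (splitAt n (base c)) ≡ 0
    toBase-target c = trans (toBase-base c c) (d-refl c)

    toLeaves-target : ∀ c y → toLeaves c (splitAt n (leaf c y)) ≡ 0
    toLeaves-target c y = trans (toLeaves-leaf c c y) (leafToLeaves-self c)

    base-dist-base : ∀ i c → Dist C (base i) (base c) (d i c)
    base-dist-base i c = potential⇒dist (toBase c ∘ splitAt n) (toBase-lipschitz c)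
      (toBase-target c) (toBase-base c i) (lift (shortest-walk i c))

    leaf-dist-base : ∀ i x c → Dist C (leaf i x) (base c) (suc (d i c))
    leaf-dist-base i x c = potential⇒dist (toBase c ∘ splitAt n) (toBase-lipschitz c)
      (toBase-target c) (toBase-leaf c i x) (step (spoke⁻¹ i x) (lift (shortest-walk i c)))

    base-dist-leaf : ∀ i c y → Dist C (base i) (leaf c y) (suc (d i c))
    base-dist-leaf i c y = potential⇒dist (toLeaves c ∘ splitAt n) (toLeaves-lipschitz c)
      (toLeaves-target c y) (cong (toLeaves c) (splitAt-base i))
      (lift (shortest-walk i c) ∷ʳ spoke c y)

    leaf-dist-leaf : ∀ {i c} → i ≢ c → ∀ x y → Dist C (leaf i x) (leaf c y) (suc (suc (d i c)))
    leaf-dist-leaf {i} {c} i≢c x y = potential⇒dist (toLeaves c ∘ splitAt n) (toLeaves-lipschitz c)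
      (toLeaves-target c y) (trans (toLeaves-leaf c i x) (leafToLeaves-other i≢c))
      (step (spoke⁻¹ i x) (lift (shortest-walk i c) ∷ʳ spoke c y))

    column-walk : ∀ i x y → Walk C (leaf i x) (leaf i y) 2
    column-walk i x y = step (spoke⁻¹ i x) (step (spoke i y) here)

    same-column-unbisected : ∀ {i j} → (∀ l → d l i ≢ d l j) → ∀ {z x y} →
                             ¬ EqDist C (leaf i z) (leaf i x) (leaf j y)
    same-column-unbisected {i} {j} unbisected {z} {x} {y} (k , Dₓ , Dᵧ) =
      unbisected i (trans (d-refl i) (≡.sym dij≡0))
      where
      i≢j : i ≢ j
      i≢j refl = unbisected i refl

      2+dij≤2 : suc (suc (d i j)) ≤ 2
      2+dij≤2 = subst (_≤ 2) (dist-unique Dᵧ (leaf-dist-leaf i≢j z y))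
                             (dist-minimal Dₓ (column-walk i z x))

      dij≡0 : d i j ≡ 0
      dij≡0 = n≤0⇒n≡0 (s≤s⁻¹ (s≤s⁻¹ 2+dij≤2))

    leaves-unbisected : ∀ {i j} → (∀ l → d l i ≢ d l j) →
                        ∀ {w} x y → ¬ EqDist C w (leaf i x) (leaf j y)
    leaves-unbisected {i} {j} unbisected {w} x y E with view w
    ... | base-view l = unbisected l
      (suc-injective (equidistant⁻ E (base-dist-leaf l i x) (base-dist-leaf l j y)))
    ... | leaf-view l z with l Fin.≟ i | l Fin.≟ j
    ...   | yes refl | _        = same-column-unbisected unbisected E
    ...   | no _     | yes refl = same-column-unbisected (λ l → unbisected l ∘ ≡.sym) (map₂ swap E)
    ...   | no l≢i   | no l≢j   = unbisected l (suc-injective (suc-injective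
      (equidistant⁻ E (leaf-dist-leaf l≢i z x) (leaf-dist-leaf l≢j z y))))

    base-leaf-unbisected : ∀ {w j x} → (∀ z → w ≢ leaf j z) → ¬ EqDist C w (base j) (leaf j x)
    base-leaf-unbisected {w} {j} {x} outside E with view w
    ... | base-view l   =
      1+n≢n (≡.sym (equidistant⁻ E (base-dist-base l j) (base-dist-leaf l j x)))
    ... | leaf-view l z =
      1+n≢n (≡.sym (equidistant⁻ E (leaf-dist-base l z j) (leaf-dist-leaf l≢j z x)))
      where
      l≢j : l ≢ j
      l≢j refl = outside z refl

    module _ {S} (equalizer : IsDistanceEqualizer C S) where

      column-meets : Fin m → ∀ j → base j ∈ S ⊎ ∃[ x ] leaf j x ∈ S
      column-meets x₀ j with base j ∈? S | any? (λ x → leaf j x ∈? S)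
      ... | yes base∈S | _          = inj₁ base∈S
      ... | no  _      | yes leaf∈S = inj₂ leaf∈S
      ... | no  base∉S | no none
        with equalizer (base j) (leaf j x₀) base≢leaf base∉S (none ∘ (x₀ ,_))
      ...   | w , w∈S , E = ⊥-elim (base-leaf-unbisected outside E)
        where
        outside : ∀ z → w ≢ leaf j z
        outside z w≡leaf = none (z , subst (_∈ S) w≡leaf w∈S)

      leaves-cover : ∀ i j → (∀ l → d l i ≢ d l j) → (∀ x → leaf i x ∈ S) ⊎ (∀ y → leaf j y ∈ S)
      leaves-cover i j unbisected with all? (λ x → leaf i x ∈? S)
      ... | yes full = inj₁ full
      ... | no ¬full = inj₂ λ y → decidable-stable (leaf j y ∈? S) λ leafⱼ∉S →
        let x , leafᵢ∉S = ¬∀⟶∃¬ m _ (λ x → leaf i x ∈? S) ¬full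
            _ , _ , E   = equalizer (leaf i x) (leaf j y) (i≢j ∘ leaf-injectiveˡ) leafᵢ∉S leafⱼ∉S
        in leaves-unbisected unbisected x y E
        where
        i≢j : i ≢ j
        i≢j refl = unbisected i refl

      coronaSet-minimal : Fin m → ∀ {σ} → CompleteBipartiteBy (BisectorAdj (adj G)) σ →
                          Σ[ h ∈ (Fin n → Bool) ] CompleteBipartiteBy (BisectorAdj (adj G)) h ×
                            ∣ coronaSet h ∣ ≤ ∣ S ∣
      coronaSet-minimal x₀ bip
        with cover⊇side bip (λ i → all? (λ x → leaf i x ∈? S))
                            (λ u v r → leaves-cover u v (bisector⇒unbisected r))
      ... | h , bip-h , heavy = h , bip-h , ∣coronaSet∣≤∣S∣ h (column-meets x₀) heavy

    module _ (x₀ : Fin m) {h : Fin n → Bool}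
             (bip : CompleteBipartiteBy (BisectorAdj (adj G)) h) where

      -- A light column l is represented in coronaSet h by its base vertex, a heavy one by a
      -- leaf, which is one step (the offset) farther from every vertex outside its column.
      record Representative (l : Fin n) (offset : ℕ) : Set where
        field
          vertex  : Fin (n + n * m)
          member  : vertex ∈ coronaSet h
          to-base : ∀ j → Dist C vertex (base j) (offset + d l j)
          to-leaf : ∀ {i} x → h i ≡ false → Dist C vertex (leaf i x) (offset + suc (d l i))

      representative : ∀ l → Representative l (𝟙 (h l))
      representative l with h l in hl
      ... | false = record
        { vertex  = base l
        ; member  = base∈coronaSet h hl
        ; to-base = base-dist-base l
        ; to-leaf = λ x _ → base-dist-leaf l _ x
        }
      ... | true = record
        { vertex  = leaf l x₀
        ; member  = leaf∈coronaSet h x₀ hl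
        ; to-base = leaf-dist-base l x₀
        ; to-leaf = λ x hi →
            leaf-dist-leaf (λ { refl → contradiction (trans (≡.sym hl) hi) λ () }) x₀ x
        }

      private module R l = Representative (representative l)

      equalize : ∀ l {p q i j} → i ≡ j →
                 Dist C (R.vertex l) p (𝟙 (h l) + i) → Dist C (R.vertex l) q (𝟙 (h l) + j) →
                 Σ[ w ∈ Fin (n + n * m) ] w ∈ coronaSet h × EqDist C w p q
      equalize l refl Dₚ D_q = R.vertex l , R.member l , equidistant Dₚ D_q

      light-closer-than-heavy : ∀ {i j} → h i ≡ false → h j ≡ true → ∃[ l ] d l j ≡ suc (d l i)
      light-closer-than-heavy hi hj = closer-by-one (Graph.sym G)
        (other-side⇒unbisected bip λ hi≡hj → contradiction (trans (trans (≡.sym hi) hi≡hj) hj) λ ())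

      coronaSet-equalizer : IsDistanceEqualizer C (coronaSet h)
      coronaSet-equalizer p q _ p∉ q∉ with view p | view q
      ... | base-view j | base-view k
        with same-side⇒equidistant bip (trans (base∉⇒heavy h p∉) (≡.sym (base∉⇒heavy h q∉)))
      ...   | l , e = equalize l e (R.to-base l j) (R.to-base l k)
      coronaSet-equalizer p q _ p∉ q∉ | base-view j | leaf-view i x
        with light-closer-than-heavy (leaf∉⇒light h q∉) (base∉⇒heavy h p∉)
      ...   | l , e = equalize l e (R.to-base l j) (R.to-leaf l x (leaf∉⇒light h q∉))
      coronaSet-equalizer p q _ p∉ q∉ | leaf-view i x | base-view j
        with light-closer-than-heavy (leaf∉⇒light h p∉) (base∉⇒heavy h q∉)
      ...   | l , e = equalize l (≡.sym e) (R.to-leaf l x (leaf∉⇒light h p∉)) (R.to-base l j)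
      coronaSet-equalizer p q _ p∉ q∉ | leaf-view i x | leaf-view k y
        with same-side⇒equidistant bip (trans (leaf∉⇒light h p∉) (≡.sym (leaf∉⇒light h q∉)))
      ...   | l , e = equalize l (cong suc e)
                        (R.to-leaf l x (leaf∉⇒light h p∉)) (R.to-leaf l y (leaf∉⇒light h q∉))

proposition24 : ∀ {n m} (G : Graph n) (H : Graph m) → 1 ≤ m →
    Connected (adj G) →
    IsCompleteBipartite (BisectorAdj (adj G)) →
    ∀ (a b : ℕ) →
    IsIndependenceNumber (BisectorAdj (adj G)) a →
    IsVertexCoverNumber (BisectorAdj (adj G)) b →
    IsXi (coronaAdj (adj G) (adj H)) (b * m + a)
proposition24 {n} {m} G H 1≤m connected (σ , _ , _ , bip) a b α β with optimal-side bip α β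
... | h , bip-h , ∣side∣≡b , ∣coside∣≡a =
  (coronaSet h , coronaSet-equalizer x₀ bip-h , ∣coronaSet-h∣) , minimal
  where
  open Corona G H
  open Metric connected

  x₀ : Fin m
  x₀ = fromℕ< 1≤m

  ∣coronaSet-h∣ : ∣ coronaSet h ∣ ≡ b * m + a
  ∣coronaSet-h∣ = begin
    ∣ coronaSet h ∣                              ≡⟨ ∣coronaSet∣ h ⟩
    m * ∣ tabulate h ∣ + ∣ tabulate (not ∘ h) ∣  ≡⟨ cong₂ (λ s t → m * s + t) ∣side∣≡b ∣coside∣≡a ⟩
    m * b + a                                    ≡⟨ cong (_+ a) (*-comm m b) ⟩
    b * m + a                                    ∎
    where open ≡-Reasoning

  minimal : ∀ S → IsDistanceEqualizer C S → b * m + a ≤ ∣ S ∣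
  minimal S equalizer with coronaSet-minimal equalizer x₀ bip
  ... | h′ , bip′ , ∣coronaSet-h′∣≤∣S∣ =
    ≤-trans (b*m+a≤∣coronaSet∣ {h = h′} 1≤m bip′ α β) ∣coronaSet-h′∣≤∣S∣
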